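{- Let $G$ and $H$ be (vertex-disjoint) graphs and let $k\in\{2,3,\ldots,n(G)+n(H)\}$. Then $s\omega_k(G\vee H)=s\omega_k(G)+s\omega_k(H)$.
   Context: All graphs are finite and simple, not necessarily connected; $n(G)$ is the number of vertices. The join $G\vee H$ has vertex set $V(G)\cup V(H)$ and edge set $E(G)\cup E(H)\cup\{gh: g\in V(G),h\in V(H)\}$. For an integer $k\ge2$, a set $A\subseteq V(G)$ is a $k$-Steiner clique if the induced subgraph $G[B]$ is connected for every $B\subseteq A$ with $|B|=k$ (so every set with at most $k-1$ vertices is a $k$-Steiner clique). $s\omega_k(G)$ denotes the largest cardinality of a $k$-Steiner clique of $G$. -}

module Defs where

open import Data.Nat using (ℕ; _+_; _≤_)
open import Data.Fin using (Fin; splitAt)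
open import Data.Fin.Subset using (Subset; _∈_; _⊆_; ∣_∣)
open import Data.Sum using (_⊎_; inj₁; inj₂)
open import Data.Unit using (⊤)
open import Data.Empty using (⊥)
open import Data.Product using (Σ; _×_; _,_)
open import Relation.Nullary using (¬_; Dec; yes; no)
open import Relation.Binary.PropositionalEquality using (_≡_)

record Graph (n : ℕ) : Set₁ where
  field
    Adj    : Fin n → Fin n → Set
    sym    : ∀ {u v} → Adj u v → Adj v u
    irrefl : ∀ {u} → ¬ Adj u u
    adj?   : ∀ u v → Dec (Adj u v)
open Graph public

-- Walk from u to v in G using only vertices of B (u itself assumed in B).
data Walk {n : ℕ} (G : Graph n) (B : Subset n) : Fin n → Fin n → Set where
  here : ∀ {u} → Walk G B u u
  step : ∀ {u w v} → Adj G u w → w ∈ B → Walk G B w v → Walk G B u v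

Connected : ∀ {n} → Graph n → Subset n → Set
Connected G B = ∀ {u v} → u ∈ B → v ∈ B → Walk G B u v

SteinerClique : ∀ {n} → ℕ → Graph n → Subset n → Set
SteinerClique k G A = ∀ (B : Subset _) → B ⊆ A → ∣ B ∣ ≡ k → Connected G B

Sω : ∀ {n} → ℕ → Graph n → ℕ → Set
Sω k G m = Σ (Subset _) (λ A → SteinerClique k G A × ∣ A ∣ ≡ m)
         × (∀ A → SteinerClique k G A → ∣ A ∣ ≤ m)

-- Join of graphs: vertices Fin n ⊕ Fin m, the first n are from G.
joinAdj : ∀ {n m} → Graph n → Graph m → Fin n ⊎ Fin m → Fin n ⊎ Fin m → Set
joinAdj G H (inj₁ i) (inj₁ j) = Adj G i j
joinAdj G H (inj₂ i) (inj₂ j) = Adj H i j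
joinAdj G H (inj₁ _) (inj₂ _) = ⊤
joinAdj G H (inj₂ _) (inj₁ _) = ⊤

private
  jsym : ∀ {n m} (G : Graph n) (H : Graph m) x y → joinAdj G H x y → joinAdj G H y x
  jsym G H (inj₁ i) (inj₁ j) p = sym G p
  jsym G H (inj₂ i) (inj₂ j) p = sym H p
  jsym G H (inj₁ _) (inj₂ _) p = _
  jsym G H (inj₂ _) (inj₁ _) p = _

  jirr : ∀ {n m} (G : Graph n) (H : Graph m) x → ¬ joinAdj G H x x
  jirr G H (inj₁ i) = irrefl G
  jirr G H (inj₂ i) = irrefl H

  jdec : ∀ {n m} (G : Graph n) (H : Graph m) x y → Dec (joinAdj G H x y)
  jdec G H (inj₁ i) (inj₁ j) = adj? G i j
  jdec G H (inj₂ i) (inj₂ j) = adj? H i j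
  jdec G H (inj₁ _) (inj₂ _) = yes _
  jdec G H (inj₂ _) (inj₁ _) = yes _

_∨ᴳ_ : ∀ {n m} → Graph n → Graph m → Graph (n + m)
_∨ᴳ_ {n} G H = record
  { Adj    = λ u v → joinAdj G H (splitAt n u) (splitAt n v)
  ; sym    = λ {u} {v} → jsym G H (splitAt n u) (splitAt n v)
  ; irrefl = λ {u} → jirr G H (splitAt n u)
  ; adj?   = λ u v → jdec G H (splitAt n u) (splitAt n v)
  }

{-# OPTIONS --safe #-}
module Submission where

-- A vertex set of G ∨ H is A ++ C with A ⊆ V(G), C ⊆ V(H). A k-set lying inside one
-- side induces the same subgraph of G ∨ H as of G (resp. H), because a walk confined
-- to that side never uses a cross edge; hence A and C are k-Steiner cliques whenever
-- A ++ C is one, giving sω_k(G ∨ H) ≤ sω_k(G) + sω_k(H). Conversely, if A and C are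
-- k-Steiner cliques, a k-subset of A ++ C meeting both sides is connected through
-- the cross edges, and one inside a single side is connected by hypothesis.

open import Defs hiding (sym)
open import Data.Nat using (ℕ; suc; _+_; _≤_)
open import Data.Nat.Properties using (+-mono-≤; +-identityʳ)
open import Data.Fin using (Fin; splitAt; _↑ˡ_; _↑ʳ_)
open import Data.Fin.Properties
  using (↑ˡ-injective; ↑ʳ-injective; splitAt-↑ˡ; splitAt-↑ʳ; splitAt⁻¹-↑ˡ; splitAt⁻¹-↑ʳ)
open import Data.Fin.Subset using (Subset; _∈_; _⊆_; ∣_∣; ⊥; inside; outside; Nonempty)
open import Data.Fin.Subset.Properties using (nonempty?; Empty-unique; ∣⊥∣≡0; ∉⊥; ⊥⊆)
open import Data.Vec using ([]; _∷_; _++_)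
import Data.Vec as Vec
open import Data.Vec.Properties using (lookup-++ˡ; lookup-++ʳ; []=⇒lookup; lookup⇒[]=)
open import Data.Sum using (inj₁; inj₂)
open import Data.Unit using (tt)
open import Data.Empty using (⊥-elim)
open import Data.Product using (∃; _×_; _,_)
open import Function.Definitions using (Injective)
open import Relation.Nullary using (yes; no)
open import Relation.Binary.PropositionalEquality
  using (_≡_; refl; sym; trans; cong; cong₂; subst)

∣p++q∣≡∣p∣+∣q∣ : ∀ {n m} (p : Subset n) (q : Subset m) → ∣ p ++ q ∣ ≡ ∣ p ∣ + ∣ q ∣
∣p++q∣≡∣p∣+∣q∣ []            q = refl
∣p++q∣≡∣p∣+∣q∣ (outside ∷ p) q = ∣p++q∣≡∣p∣+∣q∣ p q
∣p++q∣≡∣p∣+∣q∣ (inside  ∷ p) q = cong suc (∣p++q∣≡∣p∣+∣q∣ p q)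

data SplitView (n m : ℕ) : Fin (n + m) → Set where
  left  : (i : Fin n) → SplitView n m (i ↑ˡ m)
  right : (j : Fin m) → SplitView n m (n ↑ʳ j)

splitView : ∀ n {m} (x : Fin (n + m)) → SplitView n m x
splitView n x with splitAt n x in eq
... | inj₁ i = subst (SplitView n _) (splitAt⁻¹-↑ˡ eq) (left i)
... | inj₂ j = subst (SplitView n _) (splitAt⁻¹-↑ʳ eq) (right j)

module _ {n m} {p : Subset n} {q : Subset m} where

  ↑ˡ∈++⁺ : ∀ {i} → i ∈ p → i ↑ˡ m ∈ p ++ q
  ↑ˡ∈++⁺ {i} i∈p = lookup⇒[]= _ (p ++ q) (trans (lookup-++ˡ p q i) ([]=⇒lookup i∈p))

  ↑ˡ∈++⁻ : ∀ {i} → i ↑ˡ m ∈ p ++ q → i ∈ p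
  ↑ˡ∈++⁻ {i} i∈p++q = lookup⇒[]= i p (trans (sym (lookup-++ˡ p q i)) ([]=⇒lookup i∈p++q))

  ↑ʳ∈++⁺ : ∀ {j} → j ∈ q → n ↑ʳ j ∈ p ++ q
  ↑ʳ∈++⁺ {j} j∈q = lookup⇒[]= _ (p ++ q) (trans (lookup-++ʳ p q j) ([]=⇒lookup j∈q))

  ↑ʳ∈++⁻ : ∀ {j} → n ↑ʳ j ∈ p ++ q → j ∈ q
  ↑ʳ∈++⁻ {j} j∈p++q = lookup⇒[]= j q (trans (sym (lookup-++ʳ p q j)) ([]=⇒lookup j∈p++q))

module _ {n m} {p p′ : Subset n} {q q′ : Subset m} where

  ++⁺-⊆ : p ⊆ p′ → q ⊆ q′ → p ++ q ⊆ p′ ++ q′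
  ++⁺-⊆ p⊆p′ q⊆q′ {x} x∈ with splitView n x
  ... | left  i = ↑ˡ∈++⁺ (p⊆p′ (↑ˡ∈++⁻ x∈))
  ... | right j = ↑ʳ∈++⁺ (q⊆q′ (↑ʳ∈++⁻ x∈))

  ++⁻ˡ-⊆ : p ++ q ⊆ p′ ++ q′ → p ⊆ p′
  ++⁻ˡ-⊆ sub i∈p = ↑ˡ∈++⁻ {q = q′} (sub (↑ˡ∈++⁺ i∈p))

  ++⁻ʳ-⊆ : p ++ q ⊆ p′ ++ q′ → q ⊆ q′
  ++⁻ʳ-⊆ sub j∈q = ↑ʳ∈++⁻ {p = p′} (sub (↑ʳ∈++⁺ j∈q))

∈p++⊥⇒∃↑ˡ : ∀ n {m} {p : Subset n} {x : Fin (n + m)} →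
            x ∈ p ++ ⊥ → ∃ λ i → x ≡ i ↑ˡ m × i ∈ p
∈p++⊥⇒∃↑ˡ n {p = p} {x} x∈ with splitView n x
... | left  i = i , refl , ↑ˡ∈++⁻ x∈
... | right j = ⊥-elim (∉⊥ (↑ʳ∈++⁻ {p = p} x∈))

∈⊥++q⇒∃↑ʳ : ∀ n {m} {q : Subset m} {x : Fin (n + m)} →
            x ∈ ⊥ ++ q → ∃ λ j → x ≡ n ↑ʳ j × j ∈ q
∈⊥++q⇒∃↑ʳ n {x = x} x∈ with splitView n x
... | left  i = ⊥-elim (∉⊥ (↑ˡ∈++⁻ x∈))
... | right j = j , refl , ↑ʳ∈++⁻ x∈

∣p++⊥∣≡∣p∣ : ∀ {n} m (p : Subset n) → ∣ p ++ ⊥ {n = m} ∣ ≡ ∣ p ∣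
∣p++⊥∣≡∣p∣ m p = trans (∣p++q∣≡∣p∣+∣q∣ p ⊥) (trans (cong (∣ p ∣ +_) (∣⊥∣≡0 m)) (+-identityʳ ∣ p ∣))

∣⊥++q∣≡∣q∣ : ∀ n {m} (q : Subset m) → ∣ ⊥ {n = n} ++ q ∣ ≡ ∣ q ∣
∣⊥++q∣≡∣q∣ n q = trans (∣p++q∣≡∣p∣+∣q∣ (⊥ {n = n}) q) (cong (_+ ∣ q ∣) (∣⊥∣≡0 n))

module _ {n n′} {G : Graph n} {G′ : Graph n′} {B : Subset n} {B′ : Subset n′}
         (f : Fin n → Fin n′) where

  map-Walk : (∀ {u v} → Adj G u v → Adj G′ (f u) (f v)) → (∀ {u} → u ∈ B → f u ∈ B′) →
             ∀ {u v} → Walk G B u v → Walk G′ B′ (f u) (f v)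
  map-Walk hom f[B]⊆B′ here              = here
  map-Walk hom f[B]⊆B′ (step uw w∈B rest) = step (hom uw) (f[B]⊆B′ w∈B) (map-Walk hom f[B]⊆B′ rest)

  pull-Walk : Injective _≡_ _≡_ f → (∀ {u v} → Adj G′ (f u) (f v) → Adj G u v) →
              (∀ {x} → x ∈ B′ → ∃ λ u → x ≡ f u × u ∈ B) →
              ∀ {u v} → Walk G′ B′ (f u) (f v) → Walk G B u v
  pull-Walk inj reflects B′⊆f[B] walk = go walk refl refl
    where
    go : ∀ {x y u v} → Walk G′ B′ x y → x ≡ f u → y ≡ f v → Walk G B u v
    go here refl fu≡fv = subst (Walk G B _) (inj fu≡fv) here
    go (step uw w∈B′ rest) refl y≡fv with B′⊆f[B] w∈B′
    ... | w , refl , w∈B = step (reflects uw) w∈B (go rest refl y≡fv)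

module _ {n m} (G : Graph n) (H : Graph m) where

  ↑ˡ-adj⁺ : ∀ {i j} → Adj G i j → Adj (G ∨ᴳ H) (i ↑ˡ m) (j ↑ˡ m)
  ↑ˡ-adj⁺ {i} {j} ij rewrite splitAt-↑ˡ n i m | splitAt-↑ˡ n j m = ij

  ↑ˡ-adj⁻ : ∀ {i j} → Adj (G ∨ᴳ H) (i ↑ˡ m) (j ↑ˡ m) → Adj G i j
  ↑ˡ-adj⁻ {i} {j} ij rewrite splitAt-↑ˡ n i m | splitAt-↑ˡ n j m = ij

  ↑ʳ-adj⁺ : ∀ {i j} → Adj H i j → Adj (G ∨ᴳ H) (n ↑ʳ i) (n ↑ʳ j)
  ↑ʳ-adj⁺ {i} {j} ij rewrite splitAt-↑ʳ n m i | splitAt-↑ʳ n m j = ij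

  ↑ʳ-adj⁻ : ∀ {i j} → Adj (G ∨ᴳ H) (n ↑ʳ i) (n ↑ʳ j) → Adj H i j
  ↑ʳ-adj⁻ {i} {j} ij rewrite splitAt-↑ʳ n m i | splitAt-↑ʳ n m j = ij

  ↑ˡ↑ʳ-adj : ∀ i j → Adj (G ∨ᴳ H) (i ↑ˡ m) (n ↑ʳ j)
  ↑ˡ↑ʳ-adj i j rewrite splitAt-↑ˡ n i m | splitAt-↑ʳ n m j = tt

  ↑ʳ↑ˡ-adj : ∀ j i → Adj (G ∨ᴳ H) (n ↑ʳ j) (i ↑ˡ m)
  ↑ʳ↑ˡ-adj j i = Graph.sym (G ∨ᴳ H) (↑ˡ↑ʳ-adj i j)

  lift-Connectedˡ : ∀ {B} → Connected G B → Connected (G ∨ᴳ H) (B ++ ⊥)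
  lift-Connectedˡ conn x∈ y∈ with ∈p++⊥⇒∃↑ˡ n x∈ | ∈p++⊥⇒∃↑ˡ n y∈
  ... | i , refl , i∈ | j , refl , j∈ = map-Walk (_↑ˡ m) ↑ˡ-adj⁺ ↑ˡ∈++⁺ (conn i∈ j∈)

  lift-Connectedʳ : ∀ {B} → Connected H B → Connected (G ∨ᴳ H) (⊥ ++ B)
  lift-Connectedʳ conn x∈ y∈ with ∈⊥++q⇒∃↑ʳ n x∈ | ∈⊥++q⇒∃↑ʳ n y∈
  ... | i , refl , i∈ | j , refl , j∈ = map-Walk (n ↑ʳ_) ↑ʳ-adj⁺ ↑ʳ∈++⁺ (conn i∈ j∈)

  restrict-Connectedˡ : ∀ {B} → Connected (G ∨ᴳ H) (B ++ ⊥) → Connected G B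
  restrict-Connectedˡ conn i∈ j∈ =
    pull-Walk (_↑ˡ m) (↑ˡ-injective m _ _) ↑ˡ-adj⁻ (∈p++⊥⇒∃↑ˡ n) (conn (↑ˡ∈++⁺ i∈) (↑ˡ∈++⁺ j∈))

  restrict-Connectedʳ : ∀ {B} → Connected (G ∨ᴳ H) (⊥ ++ B) → Connected H B
  restrict-Connectedʳ conn i∈ j∈ =
    pull-Walk (n ↑ʳ_) (↑ʳ-injective n _ _) ↑ʳ-adj⁻ (∈⊥++q⇒∃↑ʳ n) (conn (↑ʳ∈++⁺ i∈) (↑ʳ∈++⁺ j∈))

  Connected-++ : ∀ {B C} → Nonempty B → Nonempty C → Connected (G ∨ᴳ H) (B ++ C)
  Connected-++ (b , b∈) (c , c∈) {x} {y} _ y∈ with splitView n x | splitView n y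
  ... | left  i | left  j = step (↑ˡ↑ʳ-adj i c) (↑ʳ∈++⁺ c∈) (step (↑ʳ↑ˡ-adj c j) y∈ here)
  ... | left  i | right j = step (↑ˡ↑ʳ-adj i j) y∈ here
  ... | right i | left  j = step (↑ʳ↑ˡ-adj i j) y∈ here
  ... | right i | right j = step (↑ʳ↑ˡ-adj i b) (↑ˡ∈++⁺ b∈) (step (↑ˡ↑ʳ-adj b j) y∈ here)

  SteinerClique-++⁻ˡ : ∀ {k A C} → SteinerClique k (G ∨ᴳ H) (A ++ C) → SteinerClique k G A
  SteinerClique-++⁻ˡ {C = C} sc B B⊆A ∣B∣≡k =
    restrict-Connectedˡ (sc (B ++ ⊥) (++⁺-⊆ B⊆A (⊥⊆ {p = C})) (trans (∣p++⊥∣≡∣p∣ m B) ∣B∣≡k))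

  SteinerClique-++⁻ʳ : ∀ {k A C} → SteinerClique k (G ∨ᴳ H) (A ++ C) → SteinerClique k H C
  SteinerClique-++⁻ʳ {A = A} sc B B⊆C ∣B∣≡k =
    restrict-Connectedʳ (sc (⊥ ++ B) (++⁺-⊆ (⊥⊆ {p = A}) B⊆C) (trans (∣⊥++q∣≡∣q∣ n B) ∣B∣≡k))

  SteinerClique-++⁺ : ∀ {k A C} → SteinerClique k G A → SteinerClique k H C →
                      SteinerClique k (G ∨ᴳ H) (A ++ C)
  SteinerClique-++⁺ scA scC D D⊆A++C ∣D∣≡k with Vec.splitAt n D
  ... | B , B′ , refl with nonempty? B | nonempty? B′
  ...   | yes ne | yes ne′ = Connected-++ ne ne′
  ...   | no e   | _ with Empty-unique e
  ...     | refl = lift-Connectedʳ (scC B′ (++⁻ʳ-⊆ D⊆A++C) (trans (sym (∣⊥++q∣≡∣q∣ n B′)) ∣D∣≡k))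
  SteinerClique-++⁺ scA scC _ D⊆A++C ∣D∣≡k | B , B′ , refl | yes _ | no e′ with Empty-unique e′
  ...     | refl = lift-Connectedˡ (scA B (++⁻ˡ-⊆ D⊆A++C) (trans (sym (∣p++⊥∣≡∣p∣ m B)) ∣D∣≡k))

lemma4p1 : ∀ {n m} (G : Graph n) (H : Graph m) (k : ℕ) → 2 ≤ k → k ≤ n + m →
    ∀ a b → Sω k G a → Sω k H b → Sω k (G ∨ᴳ H) (a + b)
lemma4p1 {n} G H k _ _ a b ((A , scA , ∣A∣≡a) , maxA) ((C , scC , ∣C∣≡b) , maxC) =
  (A ++ C , SteinerClique-++⁺ G H scA scC , trans (∣p++q∣≡∣p∣+∣q∣ A C) (cong₂ _+_ ∣A∣≡a ∣C∣≡b))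
  , maximal
  where
  maximal : ∀ D → SteinerClique k (G ∨ᴳ H) D → ∣ D ∣ ≤ a + b
  maximal D scD with Vec.splitAt n D
  ... | B , B′ , refl rewrite ∣p++q∣≡∣p∣+∣q∣ B B′ =
    +-mono-≤ (maxA B (SteinerClique-++⁻ˡ G H scD)) (maxC B′ (SteinerClique-++⁻ʳ G H scD))
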